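{- For every $q\ge 2$, the minimal size of a tight irreducible subcube partition of $\{0,\dots,q-1\}^3$ is $2q(q-1)+1$.
   Context: A subcube of $\{0,\dots,q-1\}^n$ is a set $\{x: x_{i_1}=b_1,\dots,x_{i_d}=b_d\}$, identified with a word in $\{0,\dots,q-1,*\}^n$. A subcube partition of $\{0,\dots,q-1\}^n$ is a partition into subcubes; its size is the number of subcubes. It is irreducible if there is no subset $G$ with $1<|G|<|F|$ whose union is a subcube, and tight if for every coordinate $i\in[n]$ some subcube $s$ has $s_i\ne *$. -}

module Defs where

open import Data.Nat using (ℕ; _<_; _≤_)
open import Data.Fin using (Fin)
open import Data.Empty using (⊥)
open import Data.Fin.Subset using (Subset; ∣_∣) renaming (_∈_ to _∈ₛ_)
open import Data.Maybe using (Maybe; just; nothing)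
open import Data.List using (List; length; lookup)
open import Data.Product using (Σ; ∃; ∃-syntax; _×_)
open import Relation.Binary.PropositionalEquality using (_≡_; _≢_)
open import Function.Bundles using (_⇔_)

Point : ℕ → ℕ → Set
Point q n = Fin n → Fin q

-- A subcube, identified with a word in {0,…,q-1,*}^n; '*' is 'nothing'.
Subcube : ℕ → ℕ → Set
Subcube q n = Fin n → Maybe (Fin q)

_∈C_ : ∀ {q n} → Point q n → Subcube q n → Set
x ∈C s = ∀ i b → s i ≡ just b → x i ≡ b

Family : ℕ → ℕ → Set
Family q n = List (Subcube q n)

size : ∀ {q n} → Family q n → ℕ
size F = length F

IsPartition : ∀ {q n} → Family q n → Set
IsPartition {q} {n} F =
  (∀ (x : Point q n) → ∃[ j ] (x ∈C lookup F j)) ×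
  (∀ (x : Point q n) (j k : Fin (length F)) →
     x ∈C lookup F j → x ∈C lookup F k → j ≡ k)

UnionIs : ∀ {q n} (F : Family q n) → Subset (length F) → Subcube q n → Set
UnionIs {q} {n} F G s =
  ∀ (x : Point q n) → (x ∈C s) ⇔ (∃[ j ] (j ∈ₛ G × x ∈C lookup F j))

Irreducible : ∀ {q n} → Family q n → Set
Irreducible {q} {n} F =
  ∀ (G : Subset (length F)) → 1 < ∣ G ∣ → ∣ G ∣ < length F →
    ∀ (s : Subcube q n) → UnionIs F G s → ⊥

Tight : ∀ {q n} → Family q n → Set
Tight {q} {n} F = ∀ (i : Fin n) → ∃[ j ] (lookup F j i ≢ nothing)

TightIrreduciblePartition : ∀ {q n} → Family q n → Set
TightIrreduciblePartition F = IsPartition F × Irreducible F × Tight F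

IsMinTIPSize : ℕ → ℕ → ℕ → Set
IsMinTIPSize q n m =
  (∃[ F ] (TightIrreduciblePartition {q} {n} F × size F ≡ m)) ×
  (∀ (F : Family q n) → TightIrreduciblePartition F → m ≤ size F)

-- A tight irreducible subcube partition of [q]³ has no cube with two free coordinates. A cube free
-- everywhere contradicts tightness. A cube fixing only x_i = v meets every cube that is free in
-- coordinate i, so every cube meeting another hyperplane x_i = u fixes x_i = u; tightness supplies
-- such a u, and that hyperplane is then a proper union of at least two cubes.
-- So the cubes are points and lines, and counting points gives q³ ≤ N + (q − 1) L for N cubes of
-- which L are lines. The lines in direction k are indexed by a q × q array with no full row or column
-- (a full row would again tile a hyperplane), and lines in different directions never cross. Let α
-- and β be the numbers of occupied rows and columns for direction 2, and R and K the numbers of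
-- occupied columns for directions 0 and 1; these facts bound L by q(q − 1) + 1, so
-- N ≥ q³ − (q − 1)(q(q − 1) + 1) = 2q(q − 1) + 1. Equality holds for the lines (a, b, *), (*, 0, c),
-- (0, *, 0) and the points (0, b, c), (a, 0, 0) with a, b, c ≠ 0.

module Submission where

open import Defs
open import Data.Nat using (ℕ; zero; suc; _+_; _*_; _∸_; _≤_; _<_; z≤n; s≤s)
open import Data.Nat.Properties hiding (_≟_)
open import Data.Nat.Tactic.RingSolver using (solve-∀)
open import Data.Fin using (Fin; zero; suc; punchIn; punchOut; cast; _≟_)
open import Data.Fin.Properties using (punchIn-punchOut; ¬∀⟶∃¬; any?; cast-involutive; +↔⊎; *↔×)
open import Data.Fin.Subset using (Subset; ∣_∣; ⁅_⁆; _-_) renaming (_∈_ to _∈ₛ_; _∉_ to _∉ₛ_; ⊤ to ⊤ₛ)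
open import Data.Fin.Subset.Properties
  using ( ∈⊤; ∣⊤∣≡n; ∣⁅x⁆∣≡1; x∈⁅x⁆; x∈⁅y⁆⇒x≡y
        ; p⊆q⇒∣p∣≤∣q∣; p⊂q⇒∣p∣<∣q∣; x∈p⇒∣p-x∣<∣p∣; x∈p∧x≢y⇒x∈p-y)
open import Data.Bool using (Bool; true)
open import Data.Vec using (tabulate)
open import Data.Vec.Properties using (lookup∘tabulate; []=⇒lookup; lookup⇒[]=)
open import Data.Vec.Functional using (updateAt; _∷_; [])
open import Data.Vec.Functional.Properties using (updateAt-updates; updateAt-minimal)
open import Data.List using (List; length; lookup) renaming (tabulate to tabulateᴸ)
open import Data.List.Properties using (length-tabulate; lookup-tabulate)
open import Data.Maybe using (Maybe; just; nothing; fromMaybe)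
open import Data.Maybe.Properties using (just-injective) renaming (≡-dec to ≡-decMaybe)
open import Data.Unit using (⊤; tt)
open import Data.Empty using (⊥; ⊥-elim)
open import Data.Product using (∃; ∃-syntax; _×_; _,_; proj₁; proj₂)
open import Data.Sum using (_⊎_; inj₁; inj₂; [_,_]; swap)
open import Data.Sum.Function.Propositional using (_⊎-↔_)
open import Function using (const; _⇔_; mk⇔; Equivalence; _↔_; mk↔ₛ′; Inverse; Injection)
open import Function.Properties.Inverse using (↔⇒↣)
open import Function.Construct.Composition using (_↔-∘_)
open import Function.Construct.Identity using (↔-id)
open import Relation.Nullary using (¬_; Dec; yes; no; ¬?; does)
open import Relation.Binary.PropositionalEquality
  using (_≡_; _≢_; refl; sym; trans; cong; cong₂; subst; module ≡-Reasoning)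
open import Algebra.Properties.Semiring.Sum +-*-semiring
  using (sum; sum-syntax; sum-cong-≗; sum-remove; ∑-comm; ∑-distrib-+; *-distribˡ-sum; *-distribʳ-sum)

-- Finite sums, counts and volumes

sum-mono-≤ : ∀ {n} {f g : Fin n → ℕ} → (∀ i → f i ≤ g i) → sum f ≤ sum g
sum-mono-≤ {zero}  le = z≤n
sum-mono-≤ {suc n} le = +-mono-≤ (le zero) (sum-mono-≤ (λ i → le (suc i)))

sum-const : ∀ n k → ∑[ i < n ] k ≡ n * k
sum-const zero    k = refl
sum-const (suc n) k = cong (k +_) (sum-const n k)

sum-≤-* : ∀ {n} {f : Fin n → ℕ} {k} → (∀ i → f i ≤ k) → sum f ≤ n * k
sum-≤-* {n} {k = k} le = ≤-trans (sum-mono-≤ le) (≤-reflexive (sum-const n k))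

sum-zero : ∀ {n} {f : Fin n → ℕ} → (∀ i → f i ≡ 0) → sum f ≡ 0
sum-zero {zero}  f≡0 = refl
sum-zero {suc n} f≡0 = cong₂ _+_ (f≡0 zero) (sum-zero (λ i → f≡0 (suc i)))

term≤sum : ∀ {n} (f : Fin n → ℕ) i → f i ≤ sum f
term≤sum f zero    = m≤m+n _ _
term≤sum f (suc i) = ≤-trans (term≤sum (λ j → f (suc j)) i) (m≤n+m _ (f zero))

two-terms≤sum : ∀ {n} (f : Fin (suc n) → ℕ) {i j} → i ≢ j → f i + f j ≤ sum f
two-terms≤sum f {i} {j} i≢j = begin
  f i + f j                            ≡⟨ cong (λ k → f i + f k) (punchIn-punchOut i≢j) ⟨
  f i + f (punchIn i (punchOut i≢j))   ≤⟨ +-monoʳ-≤ (f i) (term≤sum (λ k → f (punchIn i k)) _) ⟩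
  f i + sum (λ k → f (punchIn i k))    ≡⟨ sum-remove f ⟨
  sum f                                ∎
  where open ≤-Reasoning

sum-single : ∀ {n} (f : Fin n → ℕ) i → (∀ j → j ≢ i → f j ≡ 0) → sum f ≡ f i
sum-single f zero    f≡0 = trans (cong (f zero +_) (sum-zero (λ j → f≡0 (suc j) λ ()))) (+-identityʳ _)
sum-single f (suc i) f≡0 = trans (cong (_+ sum (λ j → f (suc j))) (f≡0 zero λ ()))
                                 (sum-single (λ j → f (suc j)) i λ j j≢i → f≡0 (suc j) λ { refl → j≢i refl })

sum-*ˡ : ∀ {n} x (f : Fin n → ℕ) → ∑[ i < n ] (x * f i) ≡ x * sum f
sum-*ˡ x f = sym (*-distribˡ-sum x f)

sum-product₃ : ∀ {n} (f g h : Fin n → ℕ) →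
               ∑[ a < n ] ∑[ b < n ] ∑[ c < n ] (f a * (g b * h c)) ≡ sum f * (sum g * sum h)
sum-product₃ {n} f g h = begin
  ∑[ a < n ] ∑[ b < n ] ∑[ c < n ] (f a * (g b * h c))
    ≡⟨ sum-cong-≗ {n} (λ a → sum-cong-≗ {n} λ b →
         trans (sum-*ˡ (f a) (λ c → g b * h c)) (cong (f a *_) (sum-*ˡ (g b) h))) ⟩
  ∑[ a < n ] ∑[ b < n ] (f a * (g b * sum h))
    ≡⟨ sum-cong-≗ {n} (λ a →
         trans (sum-*ˡ (f a) (λ b → g b * sum h)) (cong (f a *_) (sym (*-distribʳ-sum (sum h) g)))) ⟩
  ∑[ a < n ] (f a * (sum g * sum h))
    ≡⟨ *-distribʳ-sum (sum g * sum h) f ⟨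
  sum f * (sum g * sum h)
    ∎
  where open ≡-Reasoning

sum≤1-with-zero : ∀ {n} {f : Fin (suc n) → ℕ} → (∀ i → f i ≤ 1) → ∀ i → f i ≡ 0 → sum f ≤ n
sum≤1-with-zero {n} {f} f≤1 i fi≡0 = begin
  sum f                             ≡⟨ sum-remove f ⟩
  f i + sum (λ k → f (punchIn i k)) ≡⟨ cong (_+ sum (λ k → f (punchIn i k))) fi≡0 ⟩
  sum (λ k → f (punchIn i k))       ≤⟨ sum-≤-* (λ k → f≤1 (punchIn i k)) ⟩
  n * 1                             ≡⟨ *-identityʳ n ⟩
  n                                 ∎
  where open ≤-Reasoning

𝟙 : ∀ {a} {A : Set a} → Dec A → ℕ
𝟙 (yes _) = 1
𝟙 (no _)  = 0

𝟙≤1 : ∀ {a} {A : Set a} (d : Dec A) → 𝟙 d ≤ 1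
𝟙≤1 (yes _) = ≤-refl
𝟙≤1 (no _)  = z≤n

𝟙-yes : ∀ {a} {A : Set a} (d : Dec A) → A → 𝟙 d ≡ 1
𝟙-yes (yes _) _ = refl
𝟙-yes (no ¬a) a = ⊥-elim (¬a a)

𝟙-no : ∀ {a} {A : Set a} (d : Dec A) → ¬ A → 𝟙 d ≡ 0
𝟙-no (yes a) ¬a = ⊥-elim (¬a a)
𝟙-no (no _)  _  = refl

𝟙-mono : ∀ {a b} {A : Set a} {B : Set b} (d : Dec A) (e : Dec B) → (A → B) → 𝟙 d ≤ 𝟙 e
𝟙-mono (yes a) e A→B = ≤-reflexive (sym (𝟙-yes e (A→B a)))
𝟙-mono (no _)  e _   = z≤n

𝟙+𝟙¬ : ∀ {a} {A : Set a} (d : Dec A) → 𝟙 d + 𝟙 (¬? d) ≡ 1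
𝟙+𝟙¬ (yes _) = refl
𝟙+𝟙¬ (no _)  = refl

𝟙+𝟙≤1 : ∀ {a b} {A : Set a} {B : Set b} (d : Dec A) (e : Dec B) → (A → B → ⊥) → 𝟙 d + 𝟙 e ≤ 1
𝟙+𝟙≤1 (yes a) (yes b) ¬ab = ⊥-elim (¬ab a b)
𝟙+𝟙≤1 (yes _) (no _)  _   = ≤-refl
𝟙+𝟙≤1 (no _)  e       _   = 𝟙≤1 e

sum-delta : ∀ {n} (i : Fin n) (g : Fin n → ℕ) → ∑[ j < n ] (𝟙 (i ≟ j) * g j) ≡ g i
sum-delta i g = begin
  ∑[ j < _ ] (𝟙 (i ≟ j) * g j)  ≡⟨ sum-single (λ j → 𝟙 (i ≟ j) * g j) i off-diagonal ⟩
  𝟙 (i ≟ i) * g i              ≡⟨ cong (_* g i) (𝟙-yes (i ≟ i) refl) ⟩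
  g i + 0                      ≡⟨ +-identityʳ (g i) ⟩
  g i                          ∎
  where
  open ≡-Reasoning
  off-diagonal : ∀ j → j ≢ i → 𝟙 (i ≟ j) * g j ≡ 0
  off-diagonal j j≢i = cong (_* g j) (𝟙-no (i ≟ j) λ i≡j → j≢i (sym i≡j))

count : ∀ {n p} {P : Fin n → Set p} → (∀ i → Dec (P i)) → ℕ
count P? = sum (λ i → 𝟙 (P? i))

module _ {n p} {P : Fin n → Set p} (P? : ∀ i → Dec (P i)) where

  count-none : (∀ i → ¬ P i) → count P? ≡ 0
  count-none ¬P = sum-zero (λ i → 𝟙-no (P? i) (¬P i))

  count+count¬ : count P? + count (λ i → ¬? (P? i)) ≡ n
  count+count¬ = begin
    count P? + count (λ i → ¬? (P? i))       ≡⟨ ∑-distrib-+ (λ i → 𝟙 (P? i)) (λ i → 𝟙 (¬? (P? i))) ⟨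
    sum (λ i → 𝟙 (P? i) + 𝟙 (¬? (P? i)))     ≡⟨ sum-cong-≗ (λ i → 𝟙+𝟙¬ (P? i)) ⟩
    ∑[ i < n ] 1                             ≡⟨ sum-const n 1 ⟩
    n * 1                                    ≡⟨ *-identityʳ n ⟩
    n                                        ∎
    where open ≡-Reasoning

  count-disjoint : ∀ {ℓ} {Q : Fin n → Set ℓ} (Q? : ∀ i → Dec (Q i)) →
                   (∀ i → P i → Q i → ⊥) → count P? + count Q? ≤ n
  count-disjoint Q? disjoint = begin
    count P? + count Q?              ≡⟨ ∑-distrib-+ (λ i → 𝟙 (P? i)) (λ i → 𝟙 (Q? i)) ⟨
    sum (λ i → 𝟙 (P? i) + 𝟙 (Q? i))  ≤⟨ sum-≤-* (λ i → 𝟙+𝟙≤1 (P? i) (Q? i) (disjoint i)) ⟩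
    n * 1                            ≡⟨ *-identityʳ n ⟩
    n                                ∎
    where open ≤-Reasoning

  sum-≤-count* : ∀ {f : Fin n → ℕ} {k} → (∀ i → ¬ P i → f i ≡ 0) → (∀ i → f i ≤ k) → sum f ≤ count P? * k
  sum-≤-count* {f} {k} vanish bounded = begin
    sum f                       ≤⟨ sum-mono-≤ (λ i → ≤𝟙* (P? i) (vanish i) (bounded i)) ⟩
    sum (λ i → 𝟙 (P? i) * k)    ≡⟨ *-distribʳ-sum k (λ i → 𝟙 (P? i)) ⟨
    count P? * k                ∎
    where
    open ≤-Reasoning
    ≤𝟙* : ∀ {A : Set p} {x} (d : Dec A) → (¬ A → x ≡ 0) → x ≤ k → x ≤ 𝟙 d * k
    ≤𝟙* (yes _) _ x≤k = ≤-trans x≤k (≤-reflexive (sym (+-identityʳ k)))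
    ≤𝟙* (no ¬a) x≡0 _ = ≤-reflexive (x≡0 ¬a)

count≤pred : ∀ {n p} {P : Fin (suc n) → Set p} (P? : ∀ i → Dec (P i)) → ¬ (∀ i → P i) → count P? ≤ n
count≤pred {n} {P = P} P? ¬all with ¬∀⟶∃¬ (suc n) P P? ¬all
... | i , ¬Pi = sum≤1-with-zero (λ j → 𝟙≤1 (P? j)) i (𝟙-no (P? i) ¬Pi)

one-star-volume≤ : ∀ m s₀ s₁ s₂ → s₀ + (s₁ + (s₂ + 0)) ≤ 1 →
                   (1 + m * s₀) * ((1 + m * s₁) * (1 + m * s₂)) ≤ 1 + m * (s₀ + (s₁ + (s₂ + 0)))
one-star-volume≤ m 0 0 s₂ _ = ≤-reflexive (identity m s₂)
  where
  identity : ∀ m s → (1 + m * 0) * ((1 + m * 0) * (1 + m * s)) ≡ 1 + m * (0 + (0 + (s + 0)))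
  identity = solve-∀
one-star-volume≤ m 0 1 0 _ = ≤-reflexive (identity m)
  where
  identity : ∀ m → (1 + m * 0) * ((1 + m * 1) * (1 + m * 0)) ≡ 1 + m * (0 + (1 + (0 + 0)))
  identity = solve-∀
one-star-volume≤ m 1 0 0 _ = ≤-reflexive (identity m)
  where
  identity : ∀ m → (1 + m * 1) * ((1 + m * 0) * (1 + m * 0)) ≡ 1 + m * (1 + (0 + (0 + 0)))
  identity = solve-∀
one-star-volume≤ m 0 1 (suc _) (s≤s ())
one-star-volume≤ m 0 (suc (suc _)) _ (s≤s ())
one-star-volume≤ m 1 0 (suc _) (s≤s ())
one-star-volume≤ m 1 (suc _) _ (s≤s ())
one-star-volume≤ m (suc (suc _)) _ _ (s≤s ())

-- The line-count inequality

complement-antitone : ∀ {a a′ b b′} → a + a′ ≡ b + b′ → a ≤ b → b′ ≤ a′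
complement-antitone {a} {a′} {b} {b′} eq a≤b = +-cancelˡ-≤ b b′ a′ (begin
  b + b′  ≡⟨ eq ⟨
  a + a′  ≤⟨ +-monoˡ-≤ a′ a≤b ⟩
  b + a′  ∎)
  where open ≤-Reasoning

-- Of the q = m + 1 rows (columns) indexing the lines in direction 2, α (β) are occupied and ᾱ (β̄)
-- are not; R and K count the occupied columns for directions 0 and 1, and Lₖ counts the lines in
-- direction k.
record LineCountBounds (m α ᾱ β β̄ R K L₀ L₁ L₂ : ℕ) : Set where
  field
    α+ᾱ   : α + ᾱ ≡ suc m
    β+β̄   : β + β̄ ≡ suc m
    R+K   : R + K ≤ suc m
    L₂≤αβ : L₂ ≤ α * β
    L₂≤αm : L₂ ≤ α * m
    L₂≤βm : L₂ ≤ β * m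
    L₀≤Rβ̄ : L₀ ≤ R * β̄
    L₀≤Rm : L₀ ≤ R * m
    L₀≤β̄m : L₀ ≤ β̄ * m
    L₁≤Kᾱ : L₁ ≤ K * ᾱ
    L₁≤Km : L₁ ≤ K * m
    L₁≤ᾱm : L₁ ≤ ᾱ * m

module _ {m α ᾱ β β̄ R K L₀ L₁ L₂ : ℕ} (c : LineCountBounds m α ᾱ β β̄ R K L₀ L₁ L₂) where
  open LineCountBounds c

  mirror : LineCountBounds m β β̄ α ᾱ K R L₁ L₀ L₂
  mirror = record
    { α+ᾱ = β+β̄ ; β+β̄ = α+ᾱ ; R+K = subst (_≤ suc m) (+-comm R K) R+K
    ; L₂≤αβ = subst (L₂ ≤_) (*-comm α β) L₂≤αβ ; L₂≤αm = L₂≤βm ; L₂≤βm = L₂≤αm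
    ; L₀≤Rβ̄ = L₁≤Kᾱ ; L₀≤Rm = L₁≤Km ; L₀≤β̄m = L₁≤ᾱm
    ; L₁≤Kᾱ = L₀≤Rβ̄ ; L₁≤Km = L₀≤Rm ; L₁≤ᾱm = L₀≤β̄m
    }

  lines≤-if-L₀≡0 : L₀ ≡ 0 → L₀ + L₁ + L₂ ≤ suc m * m
  lines≤-if-L₀≡0 L₀≡0 = begin
    L₀ + L₁ + L₂       ≡⟨ cong (λ x → x + L₁ + L₂) L₀≡0 ⟩
    L₁ + L₂            ≤⟨ +-mono-≤ L₁≤ᾱm L₂≤αm ⟩
    ᾱ * m + α * m      ≡⟨ *-distribʳ-+ m ᾱ α ⟨
    (ᾱ + α) * m        ≡⟨ cong (_* m) (trans (+-comm ᾱ α) α+ᾱ) ⟩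
    suc m * m          ∎
    where open ≤-Reasoning

  lines≤-if-L₂≡0 : L₂ ≡ 0 → L₀ + L₁ + L₂ ≤ suc m * m
  lines≤-if-L₂≡0 L₂≡0 = begin
    L₀ + L₁ + L₂       ≡⟨ trans (cong (L₀ + L₁ +_) L₂≡0) (+-identityʳ _) ⟩
    L₀ + L₁            ≤⟨ +-mono-≤ L₀≤Rm L₁≤Km ⟩
    R * m + K * m      ≡⟨ *-distribʳ-+ m R K ⟨
    (R + K) * m        ≤⟨ *-monoˡ-≤ m R+K ⟩
    suc m * m          ∎
    where open ≤-Reasoning

-- For α ≤ β (so β̄ ≤ ᾱ) and R ≥ 1 we get L₀ + L₁ ≤ β̄ + m ᾱ, and writing m = β + e the
-- remaining slack is (α − 1) e ≥ 0.
private
  lines≤-main-case : ∀ m a ᾱ β e r K → suc a + ᾱ ≡ suc m → β + suc e ≡ suc m → suc r + K ≤ suc m → suc a ≤ β →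
                   suc r * suc e + K * ᾱ + suc a * β ≤ suc m * m + 1
  lines≤-main-case m a ᾱ β e r K α+ᾱ β+β̄ R+K α≤β = begin
    suc r * suc e + K * ᾱ + suc a * β      ≤⟨ +-monoˡ-≤ (suc a * β) first-two ⟩
    suc e + m * ᾱ + suc a * β              ≤⟨ +-monoˡ-≤ (suc a * β) (+-monoˡ-≤ (m * ᾱ) (s≤s (m≤m+n e (a * e)))) ⟩
    suc (suc a * e) + m * ᾱ + suc a * β    ≡⟨ cong (λ x → suc (suc a * e) + x * ᾱ + suc a * β) m≡β+e ⟩
    suc (suc a * e) + (β + e) * ᾱ + suc a * β
                                           ≡⟨ expand a ᾱ β e ⟩
    (suc a + ᾱ) * (β + e) + 1              ≡⟨ cong₂ (λ x y → x * y + 1) α+ᾱ (sym m≡β+e) ⟩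
    suc m * m + 1                          ∎
    where
    open ≤-Reasoning
    expand : ∀ a ᾱ β e → suc (suc a * e) + (β + e) * ᾱ + suc a * β ≡ (suc a + ᾱ) * (β + e) + 1
    expand = solve-∀
    m≡β+e : m ≡ β + e
    m≡β+e = sym (suc-injective (trans (sym (+-suc β e)) β+β̄))
    β̄≤ᾱ : suc e ≤ ᾱ
    β̄≤ᾱ = complement-antitone (trans α+ᾱ (sym β+β̄)) α≤β
    first-two : suc r * suc e + K * ᾱ ≤ suc e + m * ᾱ
    first-two = begin
      suc e + r * suc e + K * ᾱ     ≡⟨ +-assoc (suc e) (r * suc e) (K * ᾱ) ⟩
      suc e + (r * suc e + K * ᾱ)   ≤⟨ +-monoʳ-≤ (suc e) (+-monoˡ-≤ (K * ᾱ) (*-monoʳ-≤ r β̄≤ᾱ)) ⟩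
      suc e + (r * ᾱ + K * ᾱ)       ≡⟨ cong (suc e +_) (*-distribʳ-+ ᾱ r K) ⟨
      suc e + (r + K) * ᾱ           ≤⟨ +-monoʳ-≤ (suc e) (*-monoˡ-≤ ᾱ (≤-pred R+K)) ⟩
      suc e + m * ᾱ                 ∎

lines≤-ordered : ∀ {m α ᾱ β β̄ R K L₀ L₁ L₂} → LineCountBounds m α ᾱ β β̄ R K L₀ L₁ L₂ →
                 α ≤ β → L₀ + L₁ + L₂ ≤ suc m * m + 1
lines≤-ordered {R = zero} c _ =
  ≤-trans (lines≤-if-L₀≡0 c (n≤0⇒n≡0 (LineCountBounds.L₀≤Rm c))) (m≤m+n _ 1)
lines≤-ordered {β̄ = zero} c _ =
  ≤-trans (lines≤-if-L₀≡0 c (n≤0⇒n≡0 (LineCountBounds.L₀≤β̄m c))) (m≤m+n _ 1)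
lines≤-ordered {α = zero} c _ =
  ≤-trans (lines≤-if-L₂≡0 c (n≤0⇒n≡0 (LineCountBounds.L₂≤αm c))) (m≤m+n _ 1)
lines≤-ordered {m} {suc a} {ᾱ} {β} {suc e} {suc r} {K} {L₀} {L₁} {L₂} c α≤β = begin
  L₀ + L₁ + L₂                         ≤⟨ +-mono-≤ (+-mono-≤ L₀≤Rβ̄ L₁≤Kᾱ) L₂≤αβ ⟩
  suc r * suc e + K * ᾱ + suc a * β    ≤⟨ lines≤-main-case m a ᾱ β e r K α+ᾱ β+β̄ R+K α≤β ⟩
  suc m * m + 1                        ∎
  where
  open ≤-Reasoning
  open LineCountBounds c

lines≤ : ∀ {m α ᾱ β β̄ R K L₀ L₁ L₂} → LineCountBounds m α ᾱ β β̄ R K L₀ L₁ L₂ →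
         L₀ + L₁ + L₂ ≤ suc m * m + 1
lines≤ {m} {α = α} {β = β} {L₀ = L₀} {L₁} {L₂} c with ≤-total α β
... | inj₁ α≤β = lines≤-ordered c α≤β
... | inj₂ β≤α = subst (_≤ suc m * m + 1) (cong (_+ L₂) (+-comm L₁ L₀)) (lines≤-ordered (mirror c) β≤α)

-- Subsets, subcubes and partitions

∣p∣≥1 : ∀ {n} {p : Subset n} {x} → x ∈ₛ p → 1 ≤ ∣ p ∣
∣p∣≥1 {x = x} x∈p = subst (_≤ _) (∣⁅x⁆∣≡1 x) (p⊆q⇒∣p∣≤∣q∣ λ y∈⁅x⁆ →
                       subst (_∈ₛ _) (sym (x∈⁅y⁆⇒x≡y x y∈⁅x⁆)) x∈p)

∣p∣≥2 : ∀ {n} {p : Subset n} {x y} → x ∈ₛ p → y ∈ₛ p → x ≢ y → 2 ≤ ∣ p ∣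
∣p∣≥2 x∈p y∈p x≢y =
  ≤-trans (s≤s (∣p∣≥1 (x∈p∧x≢y⇒x∈p-y y∈p (λ y≡x → x≢y (sym y≡x))))) (x∈p⇒∣p-x∣<∣p∣ x∈p)

∣p∣<n : ∀ {n} {p : Subset n} {x} → x ∉ₛ p → ∣ p ∣ < n
∣p∣<n {n} {p} {x} x∉p = subst (∣ p ∣ <_) (∣⊤∣≡n n) (p⊂q⇒∣p∣<∣q∣ ((λ _ → ∈⊤) , x , ∈⊤ , x∉p))

∈-tabulate : ∀ {n} (f : Fin n → Bool) {i} → i ∈ₛ tabulate f ⇔ f i ≡ true
∈-tabulate f {i} = mk⇔ (λ i∈ → trans (sym (lookup∘tabulate f i)) ([]=⇒lookup i∈))
                       (λ fi → lookup⇒[]= i _ (trans (lookup∘tabulate f i) fi))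

Fits : ∀ {q} → Maybe (Fin q) → Fin q → Set
Fits nothing  _ = ⊤
Fits (just u) a = u ≡ a

fits? : ∀ {q} (u : Maybe (Fin q)) a → Dec (Fits u a)
fits? nothing  _ = yes tt
fits? (just u) a = u ≟ a

just≢nothing : ∀ {A : Set} {a : A} → just a ≢ nothing
just≢nothing ()

star? : ∀ {A : Set} (u : Maybe A) → Dec (u ≡ nothing)
star? nothing  = yes refl
star? (just _) = no λ ()

module _ {q n : ℕ} where

  ∈C-intro : ∀ {x : Point q n} {s} → (∀ i → Fits (s i) (x i)) → x ∈C s
  ∈C-intro {x} fits i b sᵢ≡b = sym (subst (λ u → Fits u (x i)) sᵢ≡b (fits i))

  ∈C⇒Fits : ∀ {x : Point q n} {s} i → x ∈C s → Fits (s i) (x i)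
  ∈C⇒Fits {s = s} i x∈s with s i in sᵢ≡u
  ... | nothing = tt
  ... | just u  = sym (x∈s i u sᵢ≡u)

  ∈C-update : ∀ {x : Point q n} {s} {i v} → x ∈C s → Fits (s i) v → updateAt x i (const v) ∈C s
  ∈C-update {x} {s} {i} {v} x∈s fits = ∈C-intro fits′
    where
    fits′ : ∀ t → Fits (s t) (updateAt x i (const v) t)
    fits′ t with t ≟ i
    ... | yes refl = subst (Fits (s t)) (sym (updateAt-updates t x)) fits
    ... | no t≢i   = subst (Fits (s t)) (sym (updateAt-minimal t i x t≢i)) (∈C⇒Fits t x∈s)

  ∈C-along : ∀ {x y : Point q n} {s k} → s k ≡ nothing → x ∈C s → (∀ t → t ≢ k → y t ≡ x t) → y ∈C s
  ∈C-along {x} {y} {s} {k} sₖ≡* x∈s y≈x = ∈C-intro fits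
    where
    fits : ∀ t → Fits (s t) (y t)
    fits t with t ≟ k
    ... | yes refl = subst (λ u → Fits u (y t)) (sym sₖ≡*) tt
    ... | no t≢k   = subst (Fits (s t)) (sym (y≈x t t≢k)) (∈C⇒Fits t x∈s)

  hyperplane : Fin n → Fin q → Subcube q n
  hyperplane i v = updateAt (const nothing) i (const (just v))

  ∈C-fixing-only : ∀ {x : Point q n} {s i v} → s i ≡ just v → (∀ t → t ≢ i → s t ≡ nothing) → x i ≡ v → x ∈C s
  ∈C-fixing-only {x} {s} {i} sᵢ≡v free xᵢ≡v = ∈C-intro fits
    where
    fits : ∀ t → Fits (s t) (x t)
    fits t with t ≟ i
    ... | yes refl = subst (λ u → Fits u (x t)) (sym sᵢ≡v) (sym xᵢ≡v)
    ... | no t≢i   = subst (λ u → Fits u (x t)) (sym (free t t≢i)) tt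

  ∈hyperplane⁺ : ∀ {x : Point q n} {i v} → x i ≡ v → x ∈C hyperplane i v
  ∈hyperplane⁺ {i = i} = ∈C-fixing-only (updateAt-updates i (const nothing))
                                        (λ t t≢i → updateAt-minimal t i (const nothing) t≢i)

  ∈hyperplane⁻ : ∀ {x : Point q n} {i v} → x ∈C hyperplane i v → x i ≡ v
  ∈hyperplane⁻ {i = i} x∈h = x∈h i _ (updateAt-updates i (const nothing))

corner : ∀ {m n} → Subcube (suc m) n → Point (suc m) n
corner s i = fromMaybe zero (s i)

corner∈ : ∀ {m n} (s : Subcube (suc m) n) → corner s ∈C s
corner∈ s = ∈C-intro (λ i → fits (s i))
  where
  fits : ∀ u → Fits u (fromMaybe zero u)
  fits nothing  = tt
  fits (just _) = refl

another : ∀ {p} → Fin (suc (suc p)) → Fin (suc (suc p))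
another zero    = suc zero
another (suc _) = zero

another≢ : ∀ {p} (v : Fin (suc (suc p))) → another v ≢ v
another≢ zero    ()
another≢ (suc _) ()

module Partition {m n} (F : Family (suc m) n) (F-partition : IsPartition F) where

  N : ℕ
  N = length F

  cube : Fin N → Subcube (suc m) n
  cube = lookup F

  cubeOf : Point (suc m) n → Fin N
  cubeOf x = proj₁ (proj₁ F-partition x)

  ∈cubeOf : ∀ x → x ∈C cube (cubeOf x)
  ∈cubeOf x = proj₂ (proj₁ F-partition x)

  cube-unique : ∀ {x j k} → x ∈C cube j → x ∈C cube k → j ≡ k
  cube-unique {x} = proj₂ F-partition x _ _

  cubeOf-unique : ∀ {x j} → x ∈C cube j → cubeOf x ≡ j
  cubeOf-unique x∈j = cube-unique (∈cubeOf _) x∈j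

  module _ {G : Subset N} {s : Subcube (suc m) n} (s≡⋃G : UnionIs F G s) where

    union-closed : ∀ {x y j} → x ∈C s → x ∈C cube j → y ∈C cube j → y ∈C s
    union-closed {x} {y} {j} x∈s x∈j y∈j with Equivalence.to (s≡⋃G x) x∈s
    ... | j′ , j′∈G , x∈j′ = Equivalence.from (s≡⋃G y) (j , subst (_∈ₛ G) (cube-unique x∈j′ x∈j) j′∈G , y∈j)

    union-within-cube : ∀ {j} → (∀ x → x ∈C s → x ∈C cube j) → ∣ G ∣ ≤ 1
    union-within-cube {j} s⊆j = subst (∣ G ∣ ≤_) (∣⁅x⁆∣≡1 j) (p⊆q⇒∣p∣≤∣q∣ G⊆⁅j⁆)
      where
      G⊆⁅j⁆ : ∀ {j′} → j′ ∈ₛ G → j′ ∈ₛ ⁅ j ⁆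
      G⊆⁅j⁆ {j′} j′∈G = subst (_∈ₛ ⁅ j ⁆) (cube-unique (s⊆j _ corner∈s) (corner∈ (cube j′))) (x∈⁅x⁆ j)
        where
        corner∈s : corner (cube j′) ∈C s
        corner∈s = Equivalence.from (s≡⋃G _) (j′ , j′∈G , corner∈ (cube j′))

    union-everything : (∀ x → x ∈C s) → N ≤ ∣ G ∣
    union-everything all∈s = subst (_≤ ∣ G ∣) (∣⊤∣≡n N) (p⊆q⇒∣p∣≤∣q∣ ⊤⊆G)
      where
      ⊤⊆G : ∀ {j} → j ∈ₛ ⊤ₛ → j ∈ₛ G
      ⊤⊆G {j} _ with Equivalence.to (s≡⋃G (corner (cube j))) (all∈s _)
      ... | j′ , j′∈G , corner∈j′ = subst (_∈ₛ G) (cube-unique corner∈j′ (corner∈ (cube j))) j′∈G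

  no-proper-union : Irreducible F → ∀ {ℓ} {P : Fin N → Set ℓ} (P? : ∀ j → Dec (P j)) (s : Subcube (suc m) n) →
                    (∀ x → x ∈C s ⇔ P (cubeOf x)) →
                    ∀ {j₁ j₂ j₃} → P j₁ → P j₂ → j₁ ≢ j₂ → ¬ P j₃ → ⊥
  no-proper-union F-irreducible {P = P} P? s s≡⋃P P₁ P₂ j₁≢j₂ ¬P₃ =
    F-irreducible G (∣p∣≥2 (∈G⁺ P₁) (∈G⁺ P₂) j₁≢j₂) (∣p∣<n (λ j₃∈G → ¬P₃ (∈G⁻ j₃∈G))) s s≡⋃G
    where
    G : Subset N
    G = tabulate (λ j → does (P? j))
    ∈G⁺ : ∀ {j} → P j → j ∈ₛ G
    ∈G⁺ {j} Pj with P? j | Equivalence.from (∈-tabulate (λ j → does (P? j)) {j})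
    ... | yes _ | from = from refl
    ... | no ¬Pj | _   = ⊥-elim (¬Pj Pj)
    ∈G⁻ : ∀ {j} → j ∈ₛ G → P j
    ∈G⁻ {j} j∈G with P? j | Equivalence.to (∈-tabulate (λ j → does (P? j)) {j}) j∈G
    ... | yes Pj | _ = Pj
    s≡⋃G : UnionIs F G s
    s≡⋃G x = mk⇔ (λ x∈s → cubeOf x , ∈G⁺ (Equivalence.to (s≡⋃P x) x∈s) , ∈cubeOf x)
                  (λ { (j , j∈G , x∈j) → Equivalence.from (s≡⋃P x) (subst P (sym (cubeOf-unique x∈j)) (∈G⁻ j∈G)) })

module TightIrreducible {p n} (F : Family (suc (suc p)) n) (F-partition : IsPartition F)
                        (F-irreducible : Irreducible F) (F-tight : Tight F) where
  open Partition F F-partition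

  no-tiled-hyperplane : ∀ i v → (∀ x → x i ≡ v → cube (cubeOf x) i ≡ just v) →
                            ∀ {j₁ j₂} → j₁ ≢ j₂ → cube j₁ i ≡ just v → cube j₂ i ≡ just v → ⊥
  no-tiled-hyperplane i v tiled j₁≢j₂ j₁-fixes j₂-fixes =
    no-proper-union F-irreducible (λ j → ≡-decMaybe _≟_ (cube j i) (just v)) (hyperplane i v)
      (λ x → mk⇔ (λ x∈h → tiled x (∈hyperplane⁻ x∈h)) (λ fixes → ∈hyperplane⁺ (∈cubeOf x i v fixes)))
      j₁-fixes j₂-fixes j₁≢j₂ y-outside
    where
    y : Point _ n
    y = updateAt (const zero) i (const (another v))
    y-outside : cube (cubeOf y) i ≢ just v
    y-outside fixes = another≢ v (trans (sym (updateAt-updates i (const zero))) (∈cubeOf y i v fixes))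

  no-whole-cube : ∀ j (i : Fin n) → (∀ t → cube j t ≡ nothing) → ⊥
  no-whole-cube j i whole with F-tight i
  ... | j′ , j′-fixes-i = j′-fixes-i (trans (cong (λ j → cube j i) (sym j≡j′)) (whole i))
    where
    j≡j′ : j ≡ j′
    j≡j′ = cube-unique (∈C-intro {s = cube j} (λ t → subst (λ u → Fits u _) (sym (whole t)) tt)) (corner∈ (cube j′))

  module _ {j i v} (j-fixes-i : cube j i ≡ just v) (j-free : ∀ t → t ≢ i → cube j t ≡ nothing) where

    private
      meets-j : ∀ {j′ x} → x ∈C cube j′ → Fits (cube j′ i) v → j′ ≡ j
      meets-j {x = x} x∈j′ fits = cube-unique (∈C-update x∈j′ fits) (∈C-fixing-only j-fixes-i j-free (updateAt-updates i x))

      parallel-fixed : ∀ u x → x i ≡ u → cube (cubeOf x) i ≡ just u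
      parallel-fixed u x xᵢ≡u with cube (cubeOf x) i in xᵢ-free
      ... | just u′ = cong just (trans (sym (∈cubeOf x i u′ xᵢ-free)) xᵢ≡u)
      ... | nothing = ⊥-elim (just≢nothing (trans (sym j-fixes-i) (trans (cong (λ j → cube j i) (sym x-in-j)) xᵢ-free)))
        where
        x-in-j : cubeOf x ≡ j
        x-in-j = meets-j (∈cubeOf x) (subst (λ u → Fits u v) (sym xᵢ-free) tt)

      no-cube-fixes-elsewhere : ∀ {k} → k ≢ i → ∀ j′ {w} → cube j′ k ≡ just w → ⊥
      no-cube-fixes-elsewhere {k} k≢i j′ {w} j′ₖ≡w = cases (cube j′ i) refl
        where
        j′≢j : j′ ≢ j
        j′≢j refl = just≢nothing (trans (sym j′ₖ≡w) (j-free k k≢i))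
        cases : ∀ m → cube j′ i ≡ m → ⊥
        cases nothing  j′ᵢ-free = j′≢j (meets-j (corner∈ (cube j′)) (subst (λ u → Fits u v) (sym j′ᵢ-free) tt))
        cases (just u) j′ᵢ≡u     =
          no-tiled-hyperplane i u (parallel-fixed u) j′≢z j′ᵢ≡u (parallel-fixed u z (updateAt-updates i _))
          where
          z : Point _ n
          z = updateAt (updateAt (const zero) k (const (another w))) i (const u)
          j′≢z : j′ ≢ cubeOf z
          j′≢z j′≡z = another≢ w (begin
            another w  ≡⟨ updateAt-updates k (const zero) ⟨
            updateAt (const zero) k (const (another w)) k ≡⟨ updateAt-minimal k i _ k≢i ⟨
            z k        ≡⟨ ∈cubeOf z k w (subst (λ j → cube j k ≡ just w) j′≡z j′ₖ≡w) ⟩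
            w          ∎)
            where open ≡-Reasoning

    no-hyperplane-cube : ∀ {k} → k ≢ i → ⊥
    no-hyperplane-cube {k} k≢i with F-tight k
    ... | j′ , j′-fixes-k with cube j′ k in j′ₖ≡w
    ...   | nothing = j′-fixes-k refl
    ...   | just w  = no-cube-fixes-elsewhere k≢i j′ j′ₖ≡w

-- The lower bound in dimension three

c₀ c₁ c₂ : Fin 3
c₀ = zero
c₁ = suc zero
c₂ = suc (suc zero)

∈C-intro₃ : ∀ {q} {x : Point q 3} {s} → Fits (s c₀) (x c₀) → Fits (s c₁) (x c₁) → Fits (s c₂) (x c₂) → x ∈C s
∈C-intro₃ f₀ f₁ f₂ = ∈C-intro λ { zero → f₀ ; (suc zero) → f₁ ; (suc (suc zero)) → f₂ }

module _ {a} {A : Set a} {x y : Fin 3 → A} where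

  agree-off₀ : x c₁ ≡ y c₁ → x c₂ ≡ y c₂ → ∀ t → t ≢ c₀ → x t ≡ y t
  agree-off₀ _  _  zero             t≢c₀ = ⊥-elim (t≢c₀ refl)
  agree-off₀ e₁ _  (suc zero)       _    = e₁
  agree-off₀ _  e₂ (suc (suc zero)) _    = e₂

  agree-off₁ : x c₀ ≡ y c₀ → x c₂ ≡ y c₂ → ∀ t → t ≢ c₁ → x t ≡ y t
  agree-off₁ e₀ _  zero             _    = e₀
  agree-off₁ _  _  (suc zero)       t≢c₁ = ⊥-elim (t≢c₁ refl)
  agree-off₁ _  e₂ (suc (suc zero)) _    = e₂

  agree-off₂ : x c₀ ≡ y c₀ → x c₁ ≡ y c₁ → ∀ t → t ≢ c₂ → x t ≡ y t
  agree-off₂ e₀ _  zero             _    = e₀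
  agree-off₂ _  e₁ (suc zero)       _    = e₁
  agree-off₂ _  _  (suc (suc zero)) t≢c₂ = ⊥-elim (t≢c₂ refl)

spans-off₀ : ∀ t → t ≢ c₀ → t ≡ c₁ ⊎ t ≡ c₂
spans-off₀ zero             t≢c₀ = ⊥-elim (t≢c₀ refl)
spans-off₀ (suc zero)       _    = inj₁ refl
spans-off₀ (suc (suc zero)) _    = inj₂ refl

spans-off₁ : ∀ t → t ≢ c₁ → t ≡ c₀ ⊎ t ≡ c₂
spans-off₁ zero             _    = inj₁ refl
spans-off₁ (suc zero)       t≢c₁ = ⊥-elim (t≢c₁ refl)
spans-off₁ (suc (suc zero)) _    = inj₂ refl

spans-off₂ : ∀ t → t ≢ c₂ → t ≡ c₀ ⊎ t ≡ c₁
spans-off₂ zero             _    = inj₁ refl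
spans-off₂ (suc zero)       _    = inj₂ refl
spans-off₂ (suc (suc zero)) t≢c₂ = ⊥-elim (t≢c₂ refl)

module LowerBound {p} (F : Family (suc (suc p)) 3) (F-partition : IsPartition F)
                  (F-irreducible : Irreducible F) (F-tight : Tight F) where
  open Partition F F-partition
  open TightIrreducible F F-partition F-irreducible F-tight

  private
    q m : ℕ
    q = suc (suc p)
    m = suc p

  stars : Fin N → ℕ
  stars j = ∑[ t < 3 ] 𝟙 (star? (cube j t))

  stars≤1 : ∀ j → stars j ≤ 1
  stars≤1 j = bound (cube j c₀) (cube j c₁) (cube j c₂) refl refl refl
    where
    bound : ∀ u v w → cube j c₀ ≡ u → cube j c₁ ≡ v → cube j c₂ ≡ w →
            𝟙 (star? u) + (𝟙 (star? v) + (𝟙 (star? w) + 0)) ≤ 1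
    bound (just _) (just _) (just _) _ _ _ = z≤n
    bound nothing  (just _) (just _) _ _ _ = ≤-refl
    bound (just _) nothing  (just _) _ _ _ = ≤-refl
    bound (just _) (just _) nothing  _ _ _ = ≤-refl
    bound nothing  nothing  nothing  e₀ e₁ e₂ =
      ⊥-elim (no-whole-cube j c₀ λ { zero → e₀ ; (suc zero) → e₁ ; (suc (suc zero)) → e₂ })
    bound (just _) nothing  nothing  e₀ e₁ e₂ =
      ⊥-elim (no-hyperplane-cube e₀ (agree-off₀ e₁ e₂) {c₁} λ ())
    bound nothing  (just _) nothing  e₀ e₁ e₂ =
      ⊥-elim (no-hyperplane-cube e₁ (agree-off₁ e₀ e₂) {c₀} λ ())
    bound nothing  nothing  (just _) e₀ e₁ e₂ =
      ⊥-elim (no-hyperplane-cube e₂ (agree-off₂ e₀ e₁) {c₀} λ ())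

  no-two-stars : ∀ {j k t} → k ≢ t → cube j k ≡ nothing → cube j t ≡ nothing → ⊥
  no-two-stars {j} {k} {t} k≢t k-free t-free = <-irrefl refl (begin
    1 + 1                                         ≡⟨ cong₂ _+_ (𝟙-yes (star? (cube j k)) k-free)
                                                               (𝟙-yes (star? (cube j t)) t-free) ⟨
    𝟙 (star? (cube j k)) + 𝟙 (star? (cube j t))   ≤⟨ two-terms≤sum (λ t → 𝟙 (star? (cube j t))) k≢t ⟩
    stars j                                       ≤⟨ stars≤1 j ⟩
    1                                             ∎)
    where open ≤-Reasoning

  Line : Fin 3 → Point q 3 → Set
  Line k x = cube (cubeOf x) k ≡ nothing

  line? : ∀ k x → Dec (Line k x)
  line? k x = star? (cube (cubeOf x) k)

  line-through : ∀ {k x y} → Line k x → (∀ t → t ≢ k → y t ≡ x t) → cubeOf y ≡ cubeOf x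
  line-through x-line y≈x = cubeOf-unique (∈C-along x-line (∈cubeOf _) y≈x)

  line-fixed : ∀ {k x t} → Line k x → t ≢ k → cube (cubeOf x) t ≡ just (x t)
  line-fixed {k} {x} {t} x-line t≢k with cube (cubeOf x) t in xₜ-fixed
  ... | just u  = cong just (sym (∈cubeOf x t u xₜ-fixed))
  ... | nothing = ⊥-elim (no-two-stars t≢k xₜ-fixed x-line)

  no-crossing-lines : ∀ {k k′} {x y z : Point q 3} → k ≢ k′ → Line k x → Line k′ y →
                          (∀ t → t ≢ k → z t ≡ x t) → (∀ t → t ≢ k′ → z t ≡ y t) → ⊥
  no-crossing-lines {k} {k′} k≢k′ x-line y-line z≈x z≈y = no-two-stars k≢k′
    (subst (λ j → cube j k ≡ nothing) (sym (line-through x-line z≈x)) x-line)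
    (subst (λ j → cube j k′ ≡ nothing) (sym (line-through y-line z≈y)) y-line)

  lines-in-row≤ : ∀ {i o k v} (f : Fin q → Point q 3) → i ≢ k → o ≢ k → (∀ t → t ≢ k → t ≡ i ⊎ t ≡ o) →
                  (∀ w → f w i ≡ v) → (∀ w → f w o ≡ w) → count (λ w → line? k (f w)) ≤ m
  lines-in-row≤ {i} {o} {k} {v} f i≢k o≢k spans fᵢ fₒ = count≤pred (λ w → line? k (f w)) full-row-contra
    where
    full-row-contra : (∀ w → Line k (f w)) → ⊥
    full-row-contra lines = no-tiled-hyperplane i v tiled distinct (fixes-i zero) (fixes-i (suc zero))
      where
      fixes-i : ∀ w → cube (cubeOf (f w)) i ≡ just v
      fixes-i w = trans (line-fixed (lines w) i≢k) (cong just (fᵢ w))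
      fixes-o : ∀ w → cube (cubeOf (f w)) o ≡ just w
      fixes-o w = trans (line-fixed (lines w) o≢k) (cong just (fₒ w))
      tiled : ∀ x → x i ≡ v → cube (cubeOf x) i ≡ just v
      tiled x xᵢ≡v = trans (cong (λ j → cube j i) (line-through (lines (x o)) x≈f)) (fixes-i (x o))
        where
        x≈f : ∀ t → t ≢ k → x t ≡ f (x o) t
        x≈f t t≢k = [ (λ { refl → trans xᵢ≡v (sym (fᵢ (x o))) }) , (λ { refl → sym (fₒ (x o)) }) ] (spans t t≢k)
      distinct : cubeOf (f zero) ≢ cubeOf (f (suc zero))
      distinct same = 0≢1 (just-injective (trans (sym (fixes-o zero)) (trans (cong (λ j → cube j o) same) (fixes-o (suc zero)))))
        where
        0≢1 : zero ≢ suc zero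
        0≢1 ()

  Line₀ Line₁ Line₂ : Fin q → Fin q → Set
  Line₀ b c = Line c₀ (zero ∷ b ∷ c ∷ [])
  Line₁ a c = Line c₁ (a ∷ zero ∷ c ∷ [])
  Line₂ a b = Line c₂ (a ∷ b ∷ zero ∷ [])

  Line₀? : ∀ b c → Dec (Line₀ b c)
  Line₀? b c = line? c₀ (zero ∷ b ∷ c ∷ [])
  Line₁? : ∀ a c → Dec (Line₁ a c)
  Line₁? a c = line? c₁ (a ∷ zero ∷ c ∷ [])
  Line₂? : ∀ a b → Dec (Line₂ a b)
  Line₂? a b = line? c₂ (a ∷ b ∷ zero ∷ [])

  Line₀-row≤ : ∀ b → count (Line₀? b) ≤ m
  Line₀-row≤ b = lines-in-row≤ (λ c → zero ∷ b ∷ c ∷ []) (λ ()) (λ ()) spans-off₀ (λ _ → refl) (λ _ → refl)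
  Line₀-col≤ : ∀ c → count (λ b → Line₀? b c) ≤ m
  Line₀-col≤ c = lines-in-row≤ (λ b → zero ∷ b ∷ c ∷ []) (λ ()) (λ ()) (λ t t≢c₀ → swap (spans-off₀ t t≢c₀))
                               (λ _ → refl) (λ _ → refl)
  Line₁-row≤ : ∀ a → count (Line₁? a) ≤ m
  Line₁-row≤ a = lines-in-row≤ (λ c → a ∷ zero ∷ c ∷ []) (λ ()) (λ ()) spans-off₁ (λ _ → refl) (λ _ → refl)
  Line₁-col≤ : ∀ c → count (λ a → Line₁? a c) ≤ m
  Line₁-col≤ c = lines-in-row≤ (λ a → a ∷ zero ∷ c ∷ []) (λ ()) (λ ()) (λ t t≢c₁ → swap (spans-off₁ t t≢c₁))
                               (λ _ → refl) (λ _ → refl)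
  Line₂-row≤ : ∀ a → count (Line₂? a) ≤ m
  Line₂-row≤ a = lines-in-row≤ (λ b → a ∷ b ∷ zero ∷ []) (λ ()) (λ ()) spans-off₂ (λ _ → refl) (λ _ → refl)
  Line₂-col≤ : ∀ b → count (λ a → Line₂? a b) ≤ m
  Line₂-col≤ b = lines-in-row≤ (λ a → a ∷ b ∷ zero ∷ []) (λ ()) (λ ()) (λ t t≢c₂ → swap (spans-off₂ t t≢c₂))
                               (λ _ → refl) (λ _ → refl)

  Line₀-Line₁-disjoint : ∀ {a b c} → Line₀ b c → Line₁ a c → ⊥
  Line₀-Line₁-disjoint {a} {b} {c} l₀ l₁ =
    no-crossing-lines {z = a ∷ b ∷ c ∷ []} (λ ()) l₀ l₁ (agree-off₀ refl refl) (agree-off₁ refl refl)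
  Line₂-Line₀-disjoint : ∀ {a b c} → Line₂ a b → Line₀ b c → ⊥
  Line₂-Line₀-disjoint {a} {b} {c} l₂ l₀ =
    no-crossing-lines {z = a ∷ b ∷ c ∷ []} (λ ()) l₂ l₀ (agree-off₂ refl refl) (agree-off₀ refl refl)
  Line₂-Line₁-disjoint : ∀ {a b c} → Line₂ a b → Line₁ a c → ⊥
  Line₂-Line₁-disjoint {a} {b} {c} l₂ l₁ =
    no-crossing-lines {z = a ∷ b ∷ c ∷ []} (λ ()) l₂ l₁ (agree-off₂ refl refl) (agree-off₁ refl refl)

  col₀? : ∀ c → Dec (∃[ b ] Line₀ b c)
  col₀? c = any? (λ b → Line₀? b c)
  col₁? : ∀ c → Dec (∃[ a ] Line₁ a c)
  col₁? c = any? (λ a → Line₁? a c)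
  row₂? : ∀ a → Dec (∃[ b ] Line₂ a b)
  row₂? a = any? (Line₂? a)
  col₂? : ∀ b → Dec (∃[ a ] Line₂ a b)
  col₂? b = any? (λ a → Line₂? a b)

  L₀ L₁ L₂ : ℕ
  L₀ = ∑[ b < q ] count (Line₀? b)
  L₁ = ∑[ a < q ] count (Line₁? a)
  L₂ = ∑[ a < q ] count (Line₂? a)

  line-count-bounds : LineCountBounds m (count row₂?) (count (λ a → ¬? (row₂? a))) (count col₂?) (count (λ b → ¬? (col₂? b)))
                                        (count col₀?) (count col₁?) L₀ L₁ L₂
  line-count-bounds = record
    { α+ᾱ   = count+count¬ row₂?
    ; β+β̄   = count+count¬ col₂?
    ; R+K   = count-disjoint col₀? col₁? λ { c (b , l₀) (a , l₁) → Line₀-Line₁-disjoint l₀ l₁ }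
    ; L₂≤αβ = sum-≤-count* row₂? empty-row₂ λ a → sum-mono-≤ λ b → 𝟙-mono (Line₂? a b) (col₂? b) (a ,_)
    ; L₂≤αm = sum-≤-count* row₂? empty-row₂ Line₂-row≤
    ; L₂≤βm = by-columns Line₂? (sum-≤-count* col₂? empty-col₂ Line₂-col≤)
    ; L₀≤Rβ̄ = by-columns Line₀? (sum-≤-count* col₀? empty-col₀ λ c → sum-mono-≤ λ b →
                 𝟙-mono (Line₀? b c) (¬? (col₂? b)) λ { l₀ (a , l₂) → Line₂-Line₀-disjoint l₂ l₀ })
    ; L₀≤Rm = by-columns Line₀? (sum-≤-count* col₀? empty-col₀ Line₀-col≤)
    ; L₀≤β̄m = sum-≤-count* (λ b → ¬? (col₂? b))
                (λ b ¬¬col → count-none (Line₀? b) λ c l₀ → ¬¬col λ { (a , l₂) → Line₂-Line₀-disjoint l₂ l₀ })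
                Line₀-row≤
    ; L₁≤Kᾱ = by-columns Line₁? (sum-≤-count* col₁? empty-col₁ λ c → sum-mono-≤ λ a →
                 𝟙-mono (Line₁? a c) (¬? (row₂? a)) λ { l₁ (b , l₂) → Line₂-Line₁-disjoint l₂ l₁ })
    ; L₁≤Km = by-columns Line₁? (sum-≤-count* col₁? empty-col₁ Line₁-col≤)
    ; L₁≤ᾱm = sum-≤-count* (λ a → ¬? (row₂? a))
                (λ a ¬¬row → count-none (Line₁? a) λ c l₁ → ¬¬row λ { (b , l₂) → Line₂-Line₁-disjoint l₂ l₁ })
                Line₁-row≤
    }
    where
    by-columns : ∀ {P : Fin q → Fin q → Set} (P? : ∀ u v → Dec (P u v)) {k} →
                 ∑[ v < q ] count (λ u → P? u v) ≤ k → ∑[ u < q ] count (P? u) ≤ k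
    by-columns P? {k} = subst (_≤ k) (sym (∑-comm (λ u v → 𝟙 (P? u v))))
    empty-col₀ : ∀ c → ¬ (∃[ b ] Line₀ b c) → count (λ b → Line₀? b c) ≡ 0
    empty-col₀ c ¬col = count-none (λ b → Line₀? b c) λ b l₀ → ¬col (b , l₀)
    empty-col₁ : ∀ c → ¬ (∃[ a ] Line₁ a c) → count (λ a → Line₁? a c) ≡ 0
    empty-col₁ c ¬col = count-none (λ a → Line₁? a c) λ a l₁ → ¬col (a , l₁)
    empty-row₂ : ∀ a → ¬ (∃[ b ] Line₂ a b) → count (Line₂? a) ≡ 0
    empty-row₂ a ¬row = count-none (Line₂? a) λ b l₂ → ¬row (b , l₂)
    empty-col₂ : ∀ b → ¬ (∃[ a ] Line₂ a b) → count (λ a → Line₂? a b) ≡ 0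
    empty-col₂ b ¬col = count-none (λ a → Line₂? a b) λ a l₂ → ¬col (a , l₂)

  volume : Fin N → ℕ
  volume j = ∑[ a < q ] ∑[ b < q ] ∑[ c < q ] 𝟙 (cubeOf (a ∷ b ∷ c ∷ []) ≟ j)

  volumes-sum : ∑[ j < N ] volume j ≡ q * (q * (q * 1))
  volumes-sum = begin
    ∑[ j < N ] ∑[ a < q ] ∑[ b < q ] ∑[ c < q ] 𝟙 (κ a b c ≟ j)
      ≡⟨ ∑-comm (λ j a → ∑[ b < q ] ∑[ c < q ] 𝟙 (κ a b c ≟ j)) ⟩
    ∑[ a < q ] ∑[ j < N ] ∑[ b < q ] ∑[ c < q ] 𝟙 (κ a b c ≟ j)
      ≡⟨ sum-cong-≗ {q} (λ a → ∑-comm (λ j b → ∑[ c < q ] 𝟙 (κ a b c ≟ j))) ⟩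
    ∑[ a < q ] ∑[ b < q ] ∑[ j < N ] ∑[ c < q ] 𝟙 (κ a b c ≟ j)
      ≡⟨ sum-cong-≗ {q} (λ a → sum-cong-≗ {q} λ b → ∑-comm (λ j c → 𝟙 (κ a b c ≟ j))) ⟩
    ∑[ a < q ] ∑[ b < q ] ∑[ c < q ] ∑[ j < N ] 𝟙 (κ a b c ≟ j)
      ≡⟨ sum-cong-≗ {q} (λ a → sum-cong-≗ {q} λ b → sum-cong-≗ {q} λ c → one-cube a b c) ⟩
    ∑[ a < q ] ∑[ b < q ] ∑[ c < q ] 1
      ≡⟨ sum-cong-≗ {q} (λ a → sum-cong-≗ {q} λ b → sum-const q 1) ⟩
    ∑[ a < q ] ∑[ b < q ] (q * 1)
      ≡⟨ sum-cong-≗ {q} (λ a → sum-const q (q * 1)) ⟩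
    ∑[ a < q ] (q * (q * 1))
      ≡⟨ sum-const q (q * (q * 1)) ⟩
    q * (q * (q * 1))
      ∎
    where
    open ≡-Reasoning
    κ : Fin q → Fin q → Fin q → Fin N
    κ a b c = cubeOf (a ∷ b ∷ c ∷ [])
    one-cube : ∀ a b c → ∑[ j < N ] 𝟙 (κ a b c ≟ j) ≡ 1
    one-cube a b c = trans (sum-cong-≗ {N} λ j → sym (*-identityʳ _)) (sum-delta (κ a b c) (λ _ → 1))

  width : Maybe (Fin q) → ℕ
  width u = ∑[ a < q ] 𝟙 (fits? u a)

  width≡ : ∀ u → width u ≡ 1 + m * 𝟙 (star? u)
  width≡ nothing  = sum-const q 1
  width≡ (just u) = begin
    width (just u)   ≡⟨ sum-single (λ a → 𝟙 (u ≟ a)) u (λ a a≢u → 𝟙-no (u ≟ a) λ u≡a → a≢u (sym u≡a)) ⟩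
    𝟙 (u ≟ u)        ≡⟨ 𝟙-yes (u ≟ u) refl ⟩
    1                ≡⟨ cong suc (*-zeroʳ m) ⟨
    1 + m * 0        ∎
    where open ≡-Reasoning

  volume≤ : ∀ j → volume j ≤ 1 + m * stars j
  volume≤ j = begin
    volume j
      ≤⟨ sum-mono-≤ (λ a → sum-mono-≤ λ b → sum-mono-≤ λ c → in-box a b c) ⟩
    ∑[ a < q ] ∑[ b < q ] ∑[ c < q ] (𝟙 (fits? (s c₀) a) * (𝟙 (fits? (s c₁) b) * 𝟙 (fits? (s c₂) c)))
      ≡⟨ sum-product₃ (λ a → 𝟙 (fits? (s c₀) a)) (λ b → 𝟙 (fits? (s c₁) b)) (λ c → 𝟙 (fits? (s c₂) c)) ⟩
    width (s c₀) * (width (s c₁) * width (s c₂))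
      ≡⟨ cong₂ _*_ (width≡ (s c₀)) (cong₂ _*_ (width≡ (s c₁)) (width≡ (s c₂))) ⟩
    (1 + m * 𝟙 (star? (s c₀))) * ((1 + m * 𝟙 (star? (s c₁))) * (1 + m * 𝟙 (star? (s c₂))))
      ≤⟨ one-star-volume≤ m (𝟙 (star? (s c₀))) (𝟙 (star? (s c₁))) (𝟙 (star? (s c₂))) (stars≤1 j) ⟩
    1 + m * stars j
      ∎
    where
    open ≤-Reasoning
    s : Subcube q 3
    s = cube j
    in-box : ∀ a b c → 𝟙 (cubeOf (a ∷ b ∷ c ∷ []) ≟ j) ≤ 𝟙 (fits? (s c₀) a) * (𝟙 (fits? (s c₁) b) * 𝟙 (fits? (s c₂) c))
    in-box a b c with cubeOf (a ∷ b ∷ c ∷ []) ≟ j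
    ... | no _    = z≤n
    ... | yes x∈j = ≤-reflexive (sym (cong₂ _*_ (𝟙-yes (fits? (s c₀) a) (∈C⇒Fits c₀ x∈s))
                                   (cong₂ _*_ (𝟙-yes (fits? (s c₁) b) (∈C⇒Fits c₁ x∈s))
                                              (𝟙-yes (fits? (s c₂) c) (∈C⇒Fits c₂ x∈s)))))
      where
      x∈s : (a ∷ b ∷ c ∷ []) ∈C s
      x∈s = subst (λ j → _ ∈C cube j) x∈j (∈cubeOf _)

  stars-at≤ : ∀ k (base : Fin q → Fin q → Point q 3) →
              (∀ j → cube j k ≡ nothing → ∃[ u ] ∃[ v ] base u v ∈C cube j) →
              ∑[ j < N ] 𝟙 (star? (cube j k)) ≤ ∑[ u < q ] ∑[ v < q ] 𝟙 (line? k (base u v))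
  stars-at≤ k base meets = begin
    ∑[ j < N ] 𝟙 (star? (cube j k))
      ≤⟨ sum-mono-≤ counted ⟩
    ∑[ j < N ] ∑[ u < q ] ∑[ v < q ] (𝟙 (κ u v ≟ j) * 𝟙 (star? (cube j k)))
      ≡⟨ ∑-comm (λ j u → ∑[ v < q ] (𝟙 (κ u v ≟ j) * 𝟙 (star? (cube j k)))) ⟩
    ∑[ u < q ] ∑[ j < N ] ∑[ v < q ] (𝟙 (κ u v ≟ j) * 𝟙 (star? (cube j k)))
      ≡⟨ sum-cong-≗ {q} (λ u → ∑-comm (λ j v → 𝟙 (κ u v ≟ j) * 𝟙 (star? (cube j k)))) ⟩
    ∑[ u < q ] ∑[ v < q ] ∑[ j < N ] (𝟙 (κ u v ≟ j) * 𝟙 (star? (cube j k)))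
      ≡⟨ sum-cong-≗ {q} (λ u → sum-cong-≗ {q} λ v → sum-delta (κ u v) (λ j → 𝟙 (star? (cube j k)))) ⟩
    ∑[ u < q ] ∑[ v < q ] 𝟙 (line? k (base u v))
      ∎
    where
    open ≤-Reasoning
    κ : Fin q → Fin q → Fin N
    κ u v = cubeOf (base u v)
    counted : ∀ j → 𝟙 (star? (cube j k)) ≤ ∑[ u < q ] ∑[ v < q ] (𝟙 (κ u v ≟ j) * 𝟙 (star? (cube j k)))
    counted j with star? (cube j k)
    ... | no _     = z≤n
    ... | yes free with meets j free
    ...   | u , v , base∈j = ≤-trans (≤-reflexive (sym (𝟙-yes (κ u v ≟ j) (cubeOf-unique base∈j))))
                               (≤-trans (≤-trans (≤-reflexive (sym (*-identityʳ _))) (term≤sum (λ v → 𝟙 (κ u v ≟ j) * 1) v))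
                                        (term≤sum (λ u → ∑[ v < q ] (𝟙 (κ u v ≟ j) * 1)) u))

  stars≤lines : ∑[ j < N ] stars j ≤ L₀ + L₁ + L₂
  stars≤lines = begin
    ∑[ j < N ] stars j
      ≡⟨ ∑-comm (λ j t → 𝟙 (star? (cube j t))) ⟩
    ∑[ t < 3 ] ∑[ j < N ] 𝟙 (star? (cube j t))
      ≤⟨ +-mono-≤ (stars-at≤ c₀ (λ b c → zero ∷ b ∷ c ∷ []) meets₀)
        (+-mono-≤ (stars-at≤ c₁ (λ a c → a ∷ zero ∷ c ∷ []) meets₁)
        (+-mono-≤ (stars-at≤ c₂ (λ a b → a ∷ b ∷ zero ∷ []) meets₂) ≤-refl)) ⟩
    L₀ + (L₁ + (L₂ + 0))
      ≡⟨ trans (cong (λ x → L₀ + (L₁ + x)) (+-identityʳ L₂)) (sym (+-assoc L₀ L₁ L₂)) ⟩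
    L₀ + L₁ + L₂
      ∎
    where
    open ≤-Reasoning
    corner-based : ∀ {k} {base : Fin q → Fin q → Point q 3} (u v : Point q 3 → Fin q) →
                   (∀ x t → t ≢ k → base (u x) (v x) t ≡ x t) →
                   ∀ j → cube j k ≡ nothing → ∃[ u ] ∃[ v ] base u v ∈C cube j
    corner-based u v agrees j free = u x , v x , ∈C-along free (corner∈ (cube j)) (agrees x)
      where
      x : Point q 3
      x = corner (cube j)
    meets₀ : ∀ j → cube j c₀ ≡ nothing → ∃[ b ] ∃[ c ] (zero ∷ b ∷ c ∷ []) ∈C cube j
    meets₀ = corner-based (λ x → x c₁) (λ x → x c₂) λ x → agree-off₀ refl refl
    meets₁ : ∀ j → cube j c₁ ≡ nothing → ∃[ a ] ∃[ c ] (a ∷ zero ∷ c ∷ []) ∈C cube j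
    meets₁ = corner-based (λ x → x c₀) (λ x → x c₂) λ x → agree-off₁ refl refl
    meets₂ : ∀ j → cube j c₂ ≡ nothing → ∃[ a ] ∃[ b ] (a ∷ b ∷ zero ∷ []) ∈C cube j
    meets₂ = corner-based (λ x → x c₀) (λ x → x c₁) λ x → agree-off₂ refl refl

  size≥ : 2 * q * m + 1 ≤ N
  size≥ = +-cancelʳ-≤ (m * (q * m + 1)) (2 * q * m + 1) N (begin
    2 * q * m + 1 + m * (q * m + 1)   ≡⟨ cube-volume p ⟨
    q * (q * (q * 1))                 ≡⟨ volumes-sum ⟨
    ∑[ j < N ] volume j               ≤⟨ sum-mono-≤ volume≤ ⟩
    ∑[ j < N ] (1 + m * stars j)      ≡⟨ ∑-distrib-+ (λ _ → 1) (λ j → m * stars j) ⟩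
    ∑[ j < N ] 1 + ∑[ j < N ] (m * stars j)
                                      ≡⟨ cong₂ _+_ (trans (sum-const N 1) (*-identityʳ N)) (sum-*ˡ m stars) ⟩
    N + m * ∑[ j < N ] stars j        ≤⟨ +-monoʳ-≤ N (*-monoʳ-≤ m (≤-trans stars≤lines (lines≤ line-count-bounds))) ⟩
    N + m * (q * m + 1)               ∎)
    where
    open ≤-Reasoning
    cube-volume : ∀ p → suc (suc p) * (suc (suc p) * (suc (suc p) * 1)) ≡
                        2 * suc (suc p) * suc p + 1 + suc p * (suc (suc p) * suc p + 1)
    cube-volume = solve-∀

-- The construction

module Enumerated {A B : Set} {M} (enum : Fin M ↔ A) (g : A → B) where
  open Inverse enum

  list : List B
  list = tabulateᴸ (λ i → g (to i))

  length-list : length list ≡ M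
  length-list = length-tabulate (λ i → g (to i))

  label : Fin (length list) → A
  label j = to (cast length-list j)

  position : A → Fin (length list)
  position a = cast (sym length-list) (from a)

  lookup-list : ∀ j → lookup list j ≡ g (label j)
  lookup-list j = trans (cong (lookup list) (sym (cast-involutive (sym length-list) length-list j)))
                        (lookup-tabulate (λ i → g (to i)) (cast length-list j))

  label-position : ∀ a → label (position a) ≡ a
  label-position a = trans (cong to (cast-involutive length-list (sym length-list) (from a))) (strictlyInverseˡ a)

  label-injective : ∀ {j j′} → label j ≡ label j′ → j ≡ j′
  label-injective {j} {j′} same = begin
    j                                             ≡⟨ cast-involutive (sym length-list) length-list j ⟨
    cast (sym length-list) (cast length-list j)   ≡⟨ cong (cast (sym length-list)) (Injection.injective (↔⇒↣ enum) same) ⟩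
    cast (sym length-list) (cast length-list j′)  ≡⟨ cast-involutive (sym length-list) length-list j′ ⟩
    j′                                            ∎
    where open ≡-Reasoning

module Construction (p : ℕ) where

  private
    k q : ℕ
    k = suc p
    q = suc k

  -- suc : Fin k → Fin q enumerates the nonzero symbols.
  data Piece : Set where
    line₂  : Fin k → Fin k → Piece
    line₀  : Fin k → Piece
    line₁  : Piece
    point₀ : Fin k → Fin k → Piece
    point₁ : Fin k → Piece

  piece : Piece → Subcube q 3
  piece (line₂ a b)  = just (suc a) ∷ just (suc b) ∷ nothing      ∷ []
  piece (line₀ c)    = nothing      ∷ just zero    ∷ just (suc c) ∷ []
  piece line₁        = just zero    ∷ nothing      ∷ just zero    ∷ []
  piece (point₀ b c) = just zero    ∷ just (suc b) ∷ just (suc c) ∷ []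
  piece (point₁ a)   = just (suc a) ∷ just zero    ∷ just zero    ∷ []

  classify : Fin q → Fin q → Fin q → Piece
  classify (suc a) (suc b) _       = line₂ a b
  classify (suc a) zero    (suc c) = line₀ c
  classify (suc a) zero    zero    = point₁ a
  classify zero    _       zero    = line₁
  classify zero    zero    (suc c) = line₀ c
  classify zero    (suc b) (suc c) = point₀ b c

  pieceOf : Point q 3 → Piece
  pieceOf x = classify (x c₀) (x c₁) (x c₂)

  ∈pieceOf : ∀ x → x ∈C piece (pieceOf x)
  ∈pieceOf x = ∈classify (x c₀) (x c₁) (x c₂) refl refl refl
    where
    ∈classify : ∀ a b c → x c₀ ≡ a → x c₁ ≡ b → x c₂ ≡ c → x ∈C piece (classify a b c)
    ∈classify (suc a) (suc b) _       e₀ e₁ e₂ = ∈C-intro₃ (sym e₀) (sym e₁) tt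
    ∈classify (suc a) zero    (suc c) e₀ e₁ e₂ = ∈C-intro₃ tt (sym e₁) (sym e₂)
    ∈classify (suc a) zero    zero    e₀ e₁ e₂ = ∈C-intro₃ (sym e₀) (sym e₁) (sym e₂)
    ∈classify zero    _       zero    e₀ e₁ e₂ = ∈C-intro₃ (sym e₀) tt (sym e₂)
    ∈classify zero    zero    (suc c) e₀ e₁ e₂ = ∈C-intro₃ tt (sym e₁) (sym e₂)
    ∈classify zero    (suc b) (suc c) e₀ e₁ e₂ = ∈C-intro₃ (sym e₀) (sym e₁) (sym e₂)

  pieceOf-unique : ∀ {x} c → x ∈C piece c → pieceOf x ≡ c
  pieceOf-unique {x} (line₂ a b)  x∈ rewrite x∈ c₀ _ refl | x∈ c₁ _ refl = refl
  pieceOf-unique {x} (line₀ c)    x∈ rewrite x∈ c₁ _ refl | x∈ c₂ _ refl with x c₀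
  ... | zero  = refl
  ... | suc _ = refl
  pieceOf-unique {x} line₁        x∈ rewrite x∈ c₀ _ refl | x∈ c₂ _ refl = refl
  pieceOf-unique {x} (point₀ b c) x∈ rewrite x∈ c₀ _ refl | x∈ c₁ _ refl | x∈ c₂ _ refl = refl
  pieceOf-unique {x} (point₁ a)   x∈ rewrite x∈ c₀ _ refl | x∈ c₁ _ refl | x∈ c₂ _ refl = refl

  M : ℕ
  M = k * k + (k + (1 + (k * k + k)))

  pieces : Fin M ↔ Piece
  pieces = as-piece ↔-∘ (codes ↔-∘ blocks)
    where
    blocks : Fin M ↔ (Fin (k * k) ⊎ (Fin k ⊎ (Fin 1 ⊎ (Fin (k * k) ⊎ Fin k))))
    blocks = (↔-id _ ⊎-↔ ((↔-id _ ⊎-↔ ((↔-id _ ⊎-↔ +↔⊎) ↔-∘ +↔⊎)) ↔-∘ +↔⊎)) ↔-∘ +↔⊎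
    Code : Set
    Code = (Fin k × Fin k) ⊎ (Fin k ⊎ (Fin 1 ⊎ ((Fin k × Fin k) ⊎ Fin k)))
    codes : (Fin (k * k) ⊎ (Fin k ⊎ (Fin 1 ⊎ (Fin (k * k) ⊎ Fin k)))) ↔ Code
    codes = *↔× ⊎-↔ (↔-id _ ⊎-↔ (↔-id _ ⊎-↔ (*↔× ⊎-↔ ↔-id _)))
    to : Code → Piece
    to (inj₁ (a , b))                      = line₂ a b
    to (inj₂ (inj₁ c))                     = line₀ c
    to (inj₂ (inj₂ (inj₁ zero)))           = line₁
    to (inj₂ (inj₂ (inj₂ (inj₁ (b , c))))) = point₀ b c
    to (inj₂ (inj₂ (inj₂ (inj₂ a))))       = point₁ a
    from : Piece → Code
    from (line₂ a b)  = inj₁ (a , b)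
    from (line₀ c)    = inj₂ (inj₁ c)
    from line₁        = inj₂ (inj₂ (inj₁ zero))
    from (point₀ b c) = inj₂ (inj₂ (inj₂ (inj₁ (b , c))))
    from (point₁ a)   = inj₂ (inj₂ (inj₂ (inj₂ a)))
    as-piece : Code ↔ Piece
    as-piece = mk↔ₛ′ to from
      (λ { (line₂ a b) → refl ; (line₀ c) → refl ; line₁ → refl ; (point₀ b c) → refl ; (point₁ a) → refl })
      (λ { (inj₁ _) → refl ; (inj₂ (inj₁ _)) → refl ; (inj₂ (inj₂ (inj₁ zero))) → refl
         ; (inj₂ (inj₂ (inj₂ (inj₁ _)))) → refl ; (inj₂ (inj₂ (inj₂ (inj₂ _)))) → refl })

  open Enumerated pieces piece using (label; position; lookup-list; label-position; label-injective; length-list)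

  F : Family q 3
  F = Enumerated.list pieces piece

  lookup-position : ∀ c → lookup F (position c) ≡ piece c
  lookup-position c = trans (lookup-list (position c)) (cong piece (label-position c))

  ∈position : ∀ {x} c → x ∈C piece c → x ∈C lookup F (position c)
  ∈position {x} c = subst (x ∈C_) (sym (lookup-position c))

  partition : IsPartition F
  partition = (λ x → position (pieceOf x) , ∈position (pieceOf x) (∈pieceOf x))
            , λ x j j′ x∈j x∈j′ →
                label-injective {j} {j′} (trans (sym (labelled {x} {j} x∈j)) (labelled {x} {j′} x∈j′))
    where
    labelled : ∀ {x j} → x ∈C lookup F j → pieceOf x ≡ label j
    labelled {x} {j} x∈j = pieceOf-unique (label j) (subst (x ∈C_) (lookup-list j) x∈j)

  tight : Tight F
  tight i = position (point₀ zero zero) ,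
            λ free → fixed i (trans (sym (cong (λ s → s i) (lookup-position (point₀ zero zero)))) free)
    where
    fixed : ∀ i → piece (point₀ zero zero) i ≢ nothing
    fixed zero             ()
    fixed (suc zero)       ()
    fixed (suc (suc zero)) ()

  module ProperUnion {G : Subset (length F)} (1<∣G∣ : 1 < ∣ G ∣) (∣G∣<N : ∣ G ∣ < length F)
                     {s : Subcube q 3} (s≡⋃G : UnionIs F G s) where
    open Partition F partition using (union-closed; union-within-cube; union-everything)

    private
      fits : ∀ {t u a} → s t ≡ u → Fits u a → Fits (s t) a
      fits {a = a} sₜ≡u = subst (λ u → Fits u a) (sym sₜ≡u)

      ∈s : ∀ {u v w a b c} → s c₀ ≡ u → s c₁ ≡ v → s c₂ ≡ w →
           Fits u a → Fits v b → Fits w c → (a ∷ b ∷ c ∷ []) ∈C s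
      ∈s e₀ e₁ e₂ f₀ f₁ f₂ = ∈C-intro₃ (fits e₀ f₀) (fits e₁ f₁) (fits e₂ f₂)

    no-piece-leaves : ∀ {i v} c x → s i ≡ just v → piece c i ≡ nothing → x ∈C s → x ∈C piece c → ⊥
    no-piece-leaves {i} {v} c x sᵢ≡v free x∈s x∈c = another≢ v (trans (sym (updateAt-updates i x)) (y∈s i v sᵢ≡v))
      where
      y∈s : updateAt x i (const (another v)) ∈C s
      y∈s = union-closed s≡⋃G {j = position c} x∈s (∈position c x∈c)
                         (∈position c (∈C-update x∈c (subst (λ u → Fits u (another v)) (sym free) tt)))

    not-inside-piece : ∀ c → (∀ x → x ∈C s → x ∈C piece c) → ⊥
    not-inside-piece c s⊆c = <⇒≱ 1<∣G∣ (union-within-cube s≡⋃G {position c} λ x x∈s → ∈position c (s⊆c x x∈s))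

    -- Whenever s fixes a coordinate, some piece through a point of s is free in that coordinate,
    -- unless s lies inside a single piece.
    impossible : ∀ u v w → s c₀ ≡ u → s c₁ ≡ v → s c₂ ≡ w → ⊥
    impossible nothing nothing nothing e₀ e₁ e₂ =
      <⇒≱ ∣G∣<N (union-everything s≡⋃G λ x → ∈C-intro₃ (fits e₀ tt) (fits e₁ tt) (fits e₂ tt))
    impossible (just v) nothing nothing e₀ e₁ e₂ =
      no-piece-leaves (line₀ zero) (v ∷ zero ∷ suc zero ∷ []) e₀ refl (∈s e₀ e₁ e₂ refl tt tt) (∈C-intro₃ tt refl refl)
    impossible nothing (just v) nothing e₀ e₁ e₂ =
      no-piece-leaves line₁ (zero ∷ v ∷ zero ∷ []) e₁ refl (∈s e₀ e₁ e₂ tt refl tt) (∈C-intro₃ refl tt refl)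
    impossible nothing nothing (just v) e₀ e₁ e₂ =
      no-piece-leaves (line₂ zero zero) (suc zero ∷ suc zero ∷ v ∷ []) e₂ refl (∈s e₀ e₁ e₂ tt tt refl) (∈C-intro₃ refl refl tt)
    impossible (just (suc a)) (just (suc b)) nothing e₀ e₁ e₂ =
      not-inside-piece (line₂ a b) λ x x∈s → ∈C-intro₃ (sym (x∈s c₀ _ e₀)) (sym (x∈s c₁ _ e₁)) tt
    impossible (just zero) (just w) nothing e₀ e₁ e₂ =
      no-piece-leaves line₁ (zero ∷ w ∷ zero ∷ []) e₁ refl (∈s e₀ e₁ e₂ refl refl tt) (∈C-intro₃ refl tt refl)
    impossible (just (suc a)) (just zero) nothing e₀ e₁ e₂ =
      no-piece-leaves (line₀ zero) (suc a ∷ zero ∷ suc zero ∷ []) e₀ refl (∈s e₀ e₁ e₂ refl refl tt) (∈C-intro₃ tt refl refl)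
    impossible nothing (just zero) (just (suc c)) e₀ e₁ e₂ =
      not-inside-piece (line₀ c) λ x x∈s → ∈C-intro₃ tt (sym (x∈s c₁ _ e₁)) (sym (x∈s c₂ _ e₂))
    impossible nothing (just zero) (just zero) e₀ e₁ e₂ =
      no-piece-leaves line₁ (zero ∷ zero ∷ zero ∷ []) e₁ refl (∈s e₀ e₁ e₂ tt refl refl) (∈C-intro₃ refl tt refl)
    impossible nothing (just (suc b)) (just t) e₀ e₁ e₂ =
      no-piece-leaves (line₂ zero b) (suc zero ∷ suc b ∷ t ∷ []) e₂ refl (∈s e₀ e₁ e₂ tt refl refl) (∈C-intro₃ refl refl tt)
    impossible (just zero) nothing (just zero) e₀ e₁ e₂ =
      not-inside-piece line₁ λ x x∈s → ∈C-intro₃ (sym (x∈s c₀ _ e₀)) tt (sym (x∈s c₂ _ e₂))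
    impossible (just (suc a)) nothing (just t) e₀ e₁ e₂ =
      no-piece-leaves (line₂ a zero) (suc a ∷ suc zero ∷ t ∷ []) e₂ refl (∈s e₀ e₁ e₂ refl tt refl) (∈C-intro₃ refl refl tt)
    impossible (just zero) nothing (just (suc c)) e₀ e₁ e₂ =
      no-piece-leaves (line₀ c) (zero ∷ zero ∷ suc c ∷ []) e₀ refl (∈s e₀ e₁ e₂ refl tt refl) (∈C-intro₃ tt refl refl)
    impossible (just u) (just w) (just t) e₀ e₁ e₂ =
      not-inside-piece (classify u w t) λ x x∈s → subst (λ c → x ∈C piece c)
        (trans (cong₂ (λ a b → classify a b (x c₂)) (x∈s c₀ u e₀) (x∈s c₁ w e₁)) (cong (classify u w) (x∈s c₂ t e₂)))
        (∈pieceOf x)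

  irreducible : Irreducible F
  irreducible G 1<∣G∣ ∣G∣<N s s≡⋃G = ProperUnion.impossible 1<∣G∣ ∣G∣<N s≡⋃G (s c₀) (s c₁) (s c₂) refl refl refl

  size-F : size F ≡ 2 * q * (q ∸ 1) + 1
  size-F = trans length-list (count-pieces p)
    where
    count-pieces : ∀ p → suc p * suc p + (suc p + (1 + (suc p * suc p + suc p))) ≡ 2 * suc (suc p) * suc p + 1
    count-pieces = solve-∀

corollary3p8 : ∀ (q : ℕ) → 2 ≤ q → IsMinTIPSize q 3 (2 * q * (q ∸ 1) + 1)
corollary3p8 (suc (suc p)) (s≤s (s≤s z≤n)) =
  (F , (partition , irreducible , tight) , size-F) ,
  λ F′ (F′-partition , F′-irreducible , F′-tight) → LowerBound.size≥ F′ F′-partition F′-irreducible F′-tight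
  where open Construction p
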